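{- Let $T = (S, \{\theta_t : t\in\Theta\}, V)$ be a transition model. Then for every Transition Logic transition term $\tau$ the set $\|\tau\|_T = \{(X,Y) : X,Y\subseteq S,\ T\models_{X\rightarrow Y}\tau\}$ is a transition system over $S$, and for every Transition Logic formula $\phi$ the set $\|\phi\|_T = \{X\subseteq S : T\models_X\phi\}$ is a trump over $S$.
   Context: Transition systems and trumps: a transition system over a nonempty set $S$ is a nonempty relation $\theta\subseteq\mathcal P(S)\times\mathcal P(S)$ which is downwards closed in the first coordinate (if $(X,Y)\in\theta$, $X'\subseteq X$ then $(X',Y)\in\theta$), monotone in the second (if $(X,Y)\in\theta$, $Y\subseteq Y'$ then $(X,Y')\in\theta$), satisfies non-creation ($(\emptyset,Y)\in\theta$ for all $Y$) and non-triviality ($(X,\emptyset)\notin\theta$ for $X\neq\emptyset$). A trump over $S$ is a nonempty downwards closed family of subsets of $S$. A transition model over a set $\Phi$ of atomic propositions and a set $\Theta$ of atomic transition symbols is $T=(S,\{\theta_t:t\in\Theta\},V)$ where $S$ is a nonempty set of states, each $\theta_t$ is a transition system over $S$, and $V$ maps each $p\in\Phi$ to a trump $V(p)$ over $S$. Transition Logic syntax: terms $\tau ::= t \mid \phi? \mid \tau\otimes\tau \mid \tau\cap\tau \mid \tau;\tau$ and formulas $\phi ::= \top \mid p \mid \phi\vee\phi \mid \phi\wedge\phi \mid \langle\tau\rangle\phi$, with $t\in\Theta$, $p\in\Phi$. Semantics, for $X,Y\subseteq S$: $T\models_{X\rightarrow Y} t$ iff $(X,Y)\in\theta_t$; $T\models_{X\rightarrow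 Y}\phi?$ iff $T\models_X\phi$ and $X\subseteq Y$; $T\models_{X\rightarrow Y}\tau_1\otimes\tau_2$ iff $X=X_1\cup X_2$ for some $X_1,X_2$ with $T\models_{X_1\rightarrow Y}\tau_1$ and $T\models_{X_2\rightarrow Y}\tau_2$; $T\models_{X\rightarrow Y}\tau_1\cap\tau_2$ iff $T\models_{X\rightarrow Y}\tau_1$ and $T\models_{X\rightarrow Y}\tau_2$; $T\models_{X\rightarrow Y}\tau_1;\tau_2$ iff there is $Z\subseteq S$ with $T\models_{X\rightarrow Z}\tau_1$ and $T\models_{Z\rightarrow Y}\tau_2$. $T\models_X\top$ always; $T\models_X p$ iff $X\in V(p)$; $T\models_X\psi_1\vee\psi_2$ iff $T\models_X\psi_1$ or $T\models_X\psi_2$; $T\models_X\psi_1\wedge\psi_2$ iff both hold; $T\models_X\langle\tau\rangle\psi$ iff there is $Y$ with $T\models_{X\rightarrow Y}\tau$ and $T\models_Y\psi$. -}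

module Defs where

open import Level using (0ℓ) renaming (suc to lsuc)
open import Data.Empty using (⊥)
open import Data.Product using (Σ; ∃; _×_; _,_)
open import Relation.Nullary using (¬_)
open import Relation.Unary using (Pred; _⊆_; _∪_; _≐_; ∅)

Subset : Set → Set₁
Subset S = Pred S 0ℓ

NonEmptySet : {S : Set} → Subset S → Set
NonEmptySet {S} X = ¬ (∀ x → ¬ X x)

record IsTransitionSystem (S : Set) (θ : Subset S → Subset S → Set₁) : Set₁ where
  field
    nonempty      : Σ (Subset S) λ X → Σ (Subset S) λ Y → θ X Y
    downClosed    : ∀ {X X′ Y} → θ X Y → X′ ⊆ X → θ X′ Y
    monotone      : ∀ {X Y Y′} → θ X Y → Y ⊆ Y′ → θ X Y′
    nonCreation   : ∀ Y → θ ∅ Y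
    nonTriviality : ∀ X → NonEmptySet X → ¬ θ X ∅

record IsTrump (S : Set) (F : Subset S → Set₁) : Set₁ where
  field
    nonempty   : Σ (Subset S) F
    downClosed : ∀ {X X′} → F X → X′ ⊆ X → F X′

record TransitionModel (Φ Θ : Set) : Set₂ where
  field
    S          : Set
    inhabitant : S
    θ          : Θ → Subset S → Subset S → Set₁
    θ-isTS     : ∀ t → IsTransitionSystem S (θ t)
    V          : Φ → Subset S → Set₁
    V-isTrump  : ∀ p → IsTrump S (V p)

mutual
  data Term (Φ Θ : Set) : Set where
    atom  : Θ → Term Φ Θ
    test  : Formula Φ Θ → Term Φ Θ
    _⊗_   : Term Φ Θ → Term Φ Θ → Term Φ Θ
    _∩ₜ_  : Term Φ Θ → Term Φ Θ → Term Φ Θ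
    _⨾_   : Term Φ Θ → Term Φ Θ → Term Φ Θ

  data Formula (Φ Θ : Set) : Set where
    ⊤f   : Formula Φ Θ
    var  : Φ → Formula Φ Θ
    _∨f_ : Formula Φ Θ → Formula Φ Θ → Formula Φ Θ
    _∧f_ : Formula Φ Θ → Formula Φ Θ → Formula Φ Θ
    ⟨_⟩_ : Term Φ Θ → Formula Φ Θ → Formula Φ Θ

module Semantics {Φ Θ : Set} (T : TransitionModel Φ Θ) where
  open TransitionModel T
  open import Data.Unit.Polymorphic using (⊤)
  open import Data.Sum using (_⊎_)

  mutual
    _⊨_⇒_ : Term Φ Θ → Subset S → Subset S → Set₁
    atom t   ⊨ X ⇒ Y = θ t X Y
    test φ   ⊨ X ⇒ Y = (φ ⊨ X) × (X ⊆ Y)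
    (τ₁ ⊗ τ₂) ⊨ X ⇒ Y = Σ (Subset S) λ X₁ → Σ (Subset S) λ X₂ →
                          (X ≐ (X₁ ∪ X₂)) × (τ₁ ⊨ X₁ ⇒ Y) × (τ₂ ⊨ X₂ ⇒ Y)
    (τ₁ ∩ₜ τ₂) ⊨ X ⇒ Y = (τ₁ ⊨ X ⇒ Y) × (τ₂ ⊨ X ⇒ Y)
    (τ₁ ⨾ τ₂) ⊨ X ⇒ Y = Σ (Subset S) λ Z → (τ₁ ⊨ X ⇒ Z) × (τ₂ ⊨ Z ⇒ Y)

    _⊨_ : Formula Φ Θ → Subset S → Set₁
    ⊤f        ⊨ X = ⊤
    var p     ⊨ X = V p X
    (φ ∨f ψ)  ⊨ X = (φ ⊨ X) ⊎ (ψ ⊨ X)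
    (φ ∧f ψ)  ⊨ X = (φ ⊨ X) × (ψ ⊨ X)
    (⟨ τ ⟩ φ) ⊨ X = Σ (Subset S) λ Y → (τ ⊨ X ⇒ Y) × (φ ⊨ Y)

  ‖_‖ₜ : Term Φ Θ → Subset S → Subset S → Set₁
  ‖ τ ‖ₜ X Y = τ ⊨ X ⇒ Y

  ‖_‖f : Formula Φ Θ → Subset S → Set₁
  ‖ φ ‖f X = φ ⊨ X

-- Every clause of the semantics preserves the four laws, so a simultaneous induction on terms
-- and formulas carries them from the atoms to all terms and formulas. The one non-local step is
-- non-triviality of τ₁ ⨾ τ₂: if X → Z → ∅ then Z must be empty, and monotonicity of τ₁ then
-- turns X → Z into X → ∅.
module Submission where

open import Defs
open import Data.Product using (_×_; _,_; proj₁; proj₂)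
open import Data.Sum using (inj₁; inj₂; [_,_]; map)
open import Relation.Unary using (_⊆_; _∩_; ∅)

trump-∅ : {S : Set} {F : Subset S → Set₁} → IsTrump S F → F ∅
trump-∅ F-isTrump = downClosed (proj₂ nonempty) λ ()
  where open IsTrump F-isTrump

module _ {Φ Θ : Set} (T : TransitionModel Φ Θ) where
  open TransitionModel T
  open Semantics T
  module θ t = IsTransitionSystem (θ-isTS t)
  module V p = IsTrump (V-isTrump p)

  mutual
    ⊨-downClosed : ∀ φ {X X′} → φ ⊨ X → X′ ⊆ X → φ ⊨ X′
    ⊨-downClosed ⊤f       h         X′⊆X = h
    ⊨-downClosed (var p)  h         X′⊆X = V.downClosed p h X′⊆X
    ⊨-downClosed (φ ∨f ψ) (inj₁ h)  X′⊆X = inj₁ (⊨-downClosed φ h X′⊆X)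
    ⊨-downClosed (φ ∨f ψ) (inj₂ h)  X′⊆X = inj₂ (⊨-downClosed ψ h X′⊆X)
    ⊨-downClosed (φ ∧f ψ) (h , k)   X′⊆X = ⊨-downClosed φ h X′⊆X , ⊨-downClosed ψ k X′⊆X
    ⊨-downClosed (⟨ τ ⟩ φ) (Y , h , k) X′⊆X = Y , ⊨⇒-downClosed τ h X′⊆X , k

    ⊨⇒-downClosed : ∀ τ {X X′ Y} → τ ⊨ X ⇒ Y → X′ ⊆ X → τ ⊨ X′ ⇒ Y
    ⊨⇒-downClosed (atom t)   h       X′⊆X = θ.downClosed t h X′⊆X
    ⊨⇒-downClosed (test φ)   (h , X⊆Y) X′⊆X = ⊨-downClosed φ h X′⊆X , λ x → X⊆Y (X′⊆X x)
    ⊨⇒-downClosed (τ₁ ⊗ τ₂) {X′ = X′} (X₁ , X₂ , (X⊆X₁∪X₂ , _) , h₁ , h₂) X′⊆X =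
      X′ ∩ X₁ , X′ ∩ X₂ ,
      ((λ x → map (x ,_) (x ,_) (X⊆X₁∪X₂ (X′⊆X x))) , [ proj₁ , proj₁ ]) ,
      ⊨⇒-downClosed τ₁ h₁ proj₂ , ⊨⇒-downClosed τ₂ h₂ proj₂
    ⊨⇒-downClosed (τ₁ ∩ₜ τ₂) (h₁ , h₂) X′⊆X = ⊨⇒-downClosed τ₁ h₁ X′⊆X , ⊨⇒-downClosed τ₂ h₂ X′⊆X
    ⊨⇒-downClosed (τ₁ ⨾ τ₂)  (Z , h₁ , h₂) X′⊆X = Z , ⊨⇒-downClosed τ₁ h₁ X′⊆X , h₂

  ⊨⇒-monotone : ∀ τ {X Y Y′} → τ ⊨ X ⇒ Y → Y ⊆ Y′ → τ ⊨ X ⇒ Y′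
  ⊨⇒-monotone (atom t)   h               Y⊆Y′ = θ.monotone t h Y⊆Y′
  ⊨⇒-monotone (test φ)   (h , X⊆Y)       Y⊆Y′ = h , λ x → Y⊆Y′ (X⊆Y x)
  ⊨⇒-monotone (τ₁ ⊗ τ₂)  (X₁ , X₂ , X≐X₁∪X₂ , h₁ , h₂) Y⊆Y′ =
    X₁ , X₂ , X≐X₁∪X₂ , ⊨⇒-monotone τ₁ h₁ Y⊆Y′ , ⊨⇒-monotone τ₂ h₂ Y⊆Y′
  ⊨⇒-monotone (τ₁ ∩ₜ τ₂) (h₁ , h₂)       Y⊆Y′ = ⊨⇒-monotone τ₁ h₁ Y⊆Y′ , ⊨⇒-monotone τ₂ h₂ Y⊆Y′
  ⊨⇒-monotone (τ₁ ⨾ τ₂)  (Z , h₁ , h₂)   Y⊆Y′ = Z , h₁ , ⊨⇒-monotone τ₂ h₂ Y⊆Y′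

  mutual
    ⊨-∅ : ∀ φ → φ ⊨ ∅
    ⊨-∅ ⊤f        = _
    ⊨-∅ (var p)   = trump-∅ (V-isTrump p)
    ⊨-∅ (φ ∨f ψ)  = inj₁ (⊨-∅ φ)
    ⊨-∅ (φ ∧f ψ)  = ⊨-∅ φ , ⊨-∅ ψ
    ⊨-∅ (⟨ τ ⟩ φ) = ∅ , ⊨⇒-nonCreation τ ∅ , ⊨-∅ φ

    ⊨⇒-nonCreation : ∀ τ Y → τ ⊨ ∅ ⇒ Y
    ⊨⇒-nonCreation (atom t)   Y = θ.nonCreation t Y
    ⊨⇒-nonCreation (test φ)   Y = ⊨-∅ φ , λ ()
    ⊨⇒-nonCreation (τ₁ ⊗ τ₂)  Y =
      ∅ , ∅ , ((λ ()) , [ (λ ()) , (λ ()) ]) , ⊨⇒-nonCreation τ₁ Y , ⊨⇒-nonCreation τ₂ Y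
    ⊨⇒-nonCreation (τ₁ ∩ₜ τ₂) Y = ⊨⇒-nonCreation τ₁ Y , ⊨⇒-nonCreation τ₂ Y
    ⊨⇒-nonCreation (τ₁ ⨾ τ₂)  Y = ∅ , ⊨⇒-nonCreation τ₁ ∅ , ⊨⇒-nonCreation τ₂ Y

  -- Non-triviality in positive form: no double negation is needed in the induction.
  ⊨⇒∅⇒source⊆∅ : ∀ τ {X} → τ ⊨ X ⇒ ∅ → X ⊆ ∅
  ⊨⇒∅⇒source⊆∅ (atom t) {X} h {x} x∈X = θ.nonTriviality t X (λ X⊆∅ → X⊆∅ x x∈X) h
  ⊨⇒∅⇒source⊆∅ (test φ)   (_ , X⊆∅)   = X⊆∅
  ⊨⇒∅⇒source⊆∅ (τ₁ ⊗ τ₂)  (_ , _ , (X⊆X₁∪X₂ , _) , h₁ , h₂) x∈X =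
    [ ⊨⇒∅⇒source⊆∅ τ₁ h₁ , ⊨⇒∅⇒source⊆∅ τ₂ h₂ ] (X⊆X₁∪X₂ x∈X)
  ⊨⇒∅⇒source⊆∅ (τ₁ ∩ₜ τ₂) (h₁ , _)    = ⊨⇒∅⇒source⊆∅ τ₁ h₁
  ⊨⇒∅⇒source⊆∅ (τ₁ ⨾ τ₂)  (_ , h₁ , h₂) =
    ⊨⇒∅⇒source⊆∅ τ₁ (⊨⇒-monotone τ₁ h₁ (⊨⇒∅⇒source⊆∅ τ₂ h₂))

  ‖‖ₜ-isTransitionSystem : ∀ τ → IsTransitionSystem S ‖ τ ‖ₜ
  ‖‖ₜ-isTransitionSystem τ = record
    { nonempty      = ∅ , ∅ , ⊨⇒-nonCreation τ ∅
    ; downClosed    = ⊨⇒-downClosed τ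
    ; monotone      = ⊨⇒-monotone τ
    ; nonCreation   = ⊨⇒-nonCreation τ
    ; nonTriviality = λ X X≢∅ h → X≢∅ (λ _ → ⊨⇒∅⇒source⊆∅ τ h)
    }

  ‖‖f-isTrump : ∀ φ → IsTrump S ‖ φ ‖f
  ‖‖f-isTrump φ = record { nonempty = ∅ , ⊨-∅ φ ; downClosed = ⊨-downClosed φ }

mainTheorem3 : {Φ Θ : Set} (T : TransitionModel Φ Θ) →
    ((τ : Term Φ Θ) → IsTransitionSystem (TransitionModel.S T) (Semantics.‖_‖ₜ T τ))
    × ((φ : Formula Φ Θ) → IsTrump (TransitionModel.S T) (Semantics.‖_‖f T φ))
mainTheorem3 T = ‖‖ₜ-isTransitionSystem T , ‖‖f-isTrump T
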